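{- Let $\Gamma, \Delta$ be multisets of formulae and $D$ be at most one formula. If the sequent $\Gamma^p, \lrcorner \Delta^n \vdash D^n$ is provable in the intuitionistic sequent calculus, then the sequent $\Gamma \vdash \Delta, D$ is provable in the classical sequent calculus.
   Context: First-order logic with connectives $\wedge,\vee,\Rightarrow,\neg$ and quantifiers $\forall,\exists$. The classical sequent calculus is the usual cut-free multi-conclusion sequent calculus (sequents $\Gamma\vdash\Delta$ of multisets, axiom $\Gamma,A\vdash A,\Delta$, left/right rules for each connective and quantifier, contraction and weakening on both sides, no cut). The intuitionistic sequent calculus is its cut-free restriction where the right-hand side contains at most one formula. The antinegation operator $\lrcorner$ (not a connective) is defined by: $\lrcorner A = B$ if $A$ is $\neg B$, and $\lrcorner A=\neg A$ otherwise. The polarized Gödel–Gentzen translations are defined by induction: for $A$ atomic, $A^p\equiv A$ and $A^n\equiv\neg\neg A$; $(A\wedge B)^p\equiv A^p\wedge B^p$, $(A\wedge B)^n\equiv A^n\wedge B^n$; $(A\vee B)^p\equiv A^p\vee B^p$, $(A\vee B)^n\equiv\neg(\neg A^n\wedge\neg B^n)$; $(A\Rightarrow B)^p\equiv A^n\Rightarrow B^p$, $(A\Rightarrow B)^n\equiv A^p\Rightarrow B^n$; $(\neg A)^p\equiv\neg A^n$, $(\neg A)^n\equiv\neg A^p$; $(\forall x A)^p\equiv\forall x A^p$, $(\forall x A)^n\equiv\forall x A^n$; $(\exists x A)^p\equiv\exists x A^p$, $(\exists x A)^n\equiv\neg\forall x\neg A^n$. Translations and $\lrcorner$ on multisets are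 applied formula by formula; if $D$ is empty, $D^n$ is empty. -}

module Defs where

open import Data.Nat using (ℕ; zero; suc; _≤_)
open import Data.List using (List; []; _∷_; map; _++_; length)
open import Data.Maybe using (Maybe; just; nothing)
open import Data.Product using (_×_)
open import Data.Unit using (⊤)
open import Data.List.Relation.Binary.Permutation.Propositional using (_↭_)

-- First-order syntax (de Bruijn indices for bound/free variables).
-- Function and predicate symbols are named by natural numbers and
-- applied to a list of argument terms (an arbitrary signature).

data Term : Set where
  var : ℕ → Term
  fun : ℕ → List Term → Term

infixr 6 _∧'_
infixr 5 _∨'_
infixr 4 _⇒'_

data Formula : Set where
  atom : ℕ → List Term → Formula
  _∧'_ : Formula → Formula → Formula
  _∨'_ : Formula → Formula → Formula
  _⇒'_ : Formula → Formula → Formula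
  ¬'_  : Formula → Formula
  ∀'_  : Formula → Formula
  ∃'_  : Formula → Formula

Ren : Set
Ren = ℕ → ℕ

Sub : Set
Sub = ℕ → Term

extR : Ren → Ren
extR ρ zero    = zero
extR ρ (suc x) = suc (ρ x)

mutual
  renT : Ren → Term → Term
  renT ρ (var x)    = var (ρ x)
  renT ρ (fun f ts) = fun f (renTs ρ ts)

  renTs : Ren → List Term → List Term
  renTs ρ []       = []
  renTs ρ (t ∷ ts) = renT ρ t ∷ renTs ρ ts

renF : Ren → Formula → Formula
renF ρ (atom P ts) = atom P (renTs ρ ts)
renF ρ (A ∧' B)    = renF ρ A ∧' renF ρ B
renF ρ (A ∨' B)    = renF ρ A ∨' renF ρ B
renF ρ (A ⇒' B)    = renF ρ A ⇒' renF ρ B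
renF ρ (¬' A)      = ¬' renF ρ A
renF ρ (∀' A)      = ∀' renF (extR ρ) A
renF ρ (∃' A)      = ∃' renF (extR ρ) A

extS : Sub → Sub
extS σ zero    = var zero
extS σ (suc x) = renT suc (σ x)

mutual
  subT : Sub → Term → Term
  subT σ (var x)    = σ x
  subT σ (fun f ts) = fun f (subTs σ ts)

  subTs : Sub → List Term → List Term
  subTs σ []       = []
  subTs σ (t ∷ ts) = subT σ t ∷ subTs σ ts

subF : Sub → Formula → Formula
subF σ (atom P ts) = atom P (subTs σ ts)
subF σ (A ∧' B)    = subF σ A ∧' subF σ B
subF σ (A ∨' B)    = subF σ A ∨' subF σ B
subF σ (A ⇒' B)    = subF σ A ⇒' subF σ B
subF σ (¬' A)      = ¬' subF σ A
subF σ (∀' A)      = ∀' subF (extS σ) A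
subF σ (∃' A)      = ∃' subF (extS σ) A

single : Term → Sub
single t zero    = t
single t (suc x) = var x

_[_] : Formula → Term → Formula
A [ t ] = subF (single t) A

-- shift all free variables up by one (used for eigenvariable conditions:
-- index 0 is then fresh for the shifted context)
↑ : Formula → Formula
↑ = renF suc

Ctx : Set
Ctx = List Formula

-- Classical cut-free sequent calculus LK (Gentzen style: multisets
-- realised as lists modulo the exchange rule 'exch'; principal formulas
-- at the head; contraction and weakening on both sides; no cut).

infix 3 _⊢_

data _⊢_ : Ctx → Ctx → Set where
  ax    : ∀ {Γ Δ A} → A ∷ Γ ⊢ A ∷ Δ
  exch  : ∀ {Γ Γ' Δ Δ'} → Γ ↭ Γ' → Δ ↭ Δ' → Γ ⊢ Δ → Γ' ⊢ Δ'
  wL    : ∀ {Γ Δ A} → Γ ⊢ Δ → A ∷ Γ ⊢ Δ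
  wR    : ∀ {Γ Δ A} → Γ ⊢ Δ → Γ ⊢ A ∷ Δ
  cL    : ∀ {Γ Δ A} → A ∷ A ∷ Γ ⊢ Δ → A ∷ Γ ⊢ Δ
  cR    : ∀ {Γ Δ A} → Γ ⊢ A ∷ A ∷ Δ → Γ ⊢ A ∷ Δ
  ∧L₁   : ∀ {Γ Δ A B} → A ∷ Γ ⊢ Δ → (A ∧' B) ∷ Γ ⊢ Δ
  ∧L₂   : ∀ {Γ Δ A B} → B ∷ Γ ⊢ Δ → (A ∧' B) ∷ Γ ⊢ Δ
  ∧R    : ∀ {Γ Δ A B} → Γ ⊢ A ∷ Δ → Γ ⊢ B ∷ Δ → Γ ⊢ (A ∧' B) ∷ Δ
  ∨L    : ∀ {Γ Δ A B} → A ∷ Γ ⊢ Δ → B ∷ Γ ⊢ Δ → (A ∨' B) ∷ Γ ⊢ Δ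
  ∨R₁   : ∀ {Γ Δ A B} → Γ ⊢ A ∷ Δ → Γ ⊢ (A ∨' B) ∷ Δ
  ∨R₂   : ∀ {Γ Δ A B} → Γ ⊢ B ∷ Δ → Γ ⊢ (A ∨' B) ∷ Δ
  ⇒L    : ∀ {Γ₁ Γ₂ Δ₁ Δ₂ A B} → Γ₁ ⊢ A ∷ Δ₁ → B ∷ Γ₂ ⊢ Δ₂ →
          (A ⇒' B) ∷ (Γ₁ ++ Γ₂) ⊢ Δ₁ ++ Δ₂
  ⇒R    : ∀ {Γ Δ A B} → A ∷ Γ ⊢ B ∷ Δ → Γ ⊢ (A ⇒' B) ∷ Δ
  ¬L    : ∀ {Γ Δ A} → Γ ⊢ A ∷ Δ → (¬' A) ∷ Γ ⊢ Δ
  ¬R    : ∀ {Γ Δ A} → A ∷ Γ ⊢ Δ → Γ ⊢ (¬' A) ∷ Δ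
  ∀L    : ∀ {Γ Δ A} (t : Term) → (A [ t ]) ∷ Γ ⊢ Δ → (∀' A) ∷ Γ ⊢ Δ
  ∀R    : ∀ {Γ Δ A} → map ↑ Γ ⊢ A ∷ map ↑ Δ → Γ ⊢ (∀' A) ∷ Δ
  ∃L    : ∀ {Γ Δ A} → A ∷ map ↑ Γ ⊢ map ↑ Δ → (∃' A) ∷ Γ ⊢ Δ
  ∃R    : ∀ {Γ Δ A} (t : Term) → Γ ⊢ (A [ t ]) ∷ Δ → Γ ⊢ (∃' A) ∷ Δ

-- Intuitionistic sequent calculus: the restriction of LK in which every
-- sequent of the derivation has at most one formula on the right.
Intuitionistic : ∀ {Γ Δ} → Γ ⊢ Δ → Set
Intuitionistic {Δ = Δ} d = length Δ ≤ 1 × go d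
  where
  go : ∀ {Γ Δ} → Γ ⊢ Δ → Set
  go ax          = ⊤
  go (exch _ _ d) = Intuitionistic d
  go (wL d)      = Intuitionistic d
  go (wR d)      = Intuitionistic d
  go (cL d)      = Intuitionistic d
  go (cR d)      = Intuitionistic d
  go (∧L₁ d)     = Intuitionistic d
  go (∧L₂ d)     = Intuitionistic d
  go (∧R d e)    = Intuitionistic d × Intuitionistic e
  go (∨L d e)    = Intuitionistic d × Intuitionistic e
  go (∨R₁ d)     = Intuitionistic d
  go (∨R₂ d)     = Intuitionistic d
  go (⇒L d e)    = Intuitionistic d × Intuitionistic e
  go (⇒R d)      = Intuitionistic d
  go (¬L d)      = Intuitionistic d
  go (¬R d)      = Intuitionistic d
  go (∀L _ d)    = Intuitionistic d
  go (∀R d)      = Intuitionistic d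
  go (∃L d)      = Intuitionistic d
  go (∃R _ d)    = Intuitionistic d

⌟ : Formula → Formula
⌟ (¬' B) = B
⌟ A      = ¬' A

mutual
  _ᵖ : Formula → Formula
  atom P ts ᵖ = atom P ts
  (A ∧' B) ᵖ  = (A ᵖ) ∧' (B ᵖ)
  (A ∨' B) ᵖ  = (A ᵖ) ∨' (B ᵖ)
  (A ⇒' B) ᵖ  = (A ⁿ) ⇒' (B ᵖ)
  (¬' A) ᵖ    = ¬' (A ⁿ)
  (∀' A) ᵖ    = ∀' (A ᵖ)
  (∃' A) ᵖ    = ∃' (A ᵖ)

  _ⁿ : Formula → Formula
  atom P ts ⁿ = ¬' ¬' atom P ts
  (A ∧' B) ⁿ  = (A ⁿ) ∧' (B ⁿ)
  (A ∨' B) ⁿ  = ¬' ((¬' (A ⁿ)) ∧' (¬' (B ⁿ)))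
  (A ⇒' B) ⁿ  = (A ᵖ) ⇒' (B ⁿ)
  (¬' A) ⁿ    = ¬' (A ᵖ)
  (∀' A) ⁿ    = ∀' (A ⁿ)
  (∃' A) ⁿ    = ¬' (∀' (¬' (A ⁿ)))

opt : Maybe Formula → Ctx
opt nothing  = []
opt (just A) = A ∷ []

optMap : (Formula → Formula) → Maybe Formula → Maybe Formula
optMap f nothing  = nothing
optMap f (just A) = just (f A)

module Submission where

-- The proof is a simulation argument on *signed* sequents, i.e. lists of
-- formulas tagged "left" or "right".  A relation  Decode s F x  says that
-- the formula F, occurring on side s, may be read back as the signed
-- formula x: translation-specific double negations are erased and a
-- negation is interpreted as a change of side.  The main theorem
-- 'simulate' shows that any cut-free LK derivation of Γ ⊢ Δ yields a
-- derivation of every signed sequent that Γ ⊢ Δ decodes to; the proof is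
-- by induction on the derivation, each rule on F being replayed as the
-- corresponding rule(s) on its decoding, the axiom case resting on
-- 'decode-axiom'.  Finally Aᵖ on the left decodes to A on the left, Aⁿ on
-- the right to A on the right, and ⌟(Aⁿ) on the left to A on the right up
-- to one ¬R step ('restore-corner').

open import Defs
open import Data.List using (List; []; _∷_; map; _++_)
open import Data.List.Properties using (++-assoc; map-++)
open import Data.List.Relation.Binary.Pointwise using (Pointwise; []; _∷_)
  renaming (++⁺ to join-++)
open import Data.List.Relation.Binary.Permutation.Propositional
  using (_↭_; refl; prep; swap; trans; ↭-sym)
open import Data.List.Relation.Binary.Permutation.Propositional.Properties
  using (shift; shifts; ++⁺; ++⁺ˡ; ++-comm)
  renaming (++-assoc to ↭-++-assoc)
open import Data.Maybe using (Maybe; just; nothing)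
open import Data.Nat using (zero; suc)
open import Data.Product using (Σ; ∃; _×_; _,_)
open import Relation.Binary.PropositionalEquality
  using (_≡_; refl; sym; cong; cong₂; subst; subst₂)

data Side : Set where
  lf rt : Side

Signed : Set
Signed = Side × Formula

lefts : List Signed → Ctx
lefts []             = []
lefts ((lf , A) ∷ T) = A ∷ lefts T
lefts ((rt , A) ∷ T) = lefts T

rights : List Signed → Ctx
rights []             = []
rights ((lf , A) ∷ T) = rights T
rights ((rt , A) ∷ T) = A ∷ rights T

-- A signed list T stands for the sequent  lefts T ⊢ rights T.  Working
-- with one list lets a principal formula be moved to the front uniformly,
-- whichever side it lives on.
infix 3 ⊢ˢ_

record ⊢ˢ_ (T : List Signed) : Set where
  constructor mk
  field proof : lefts T ⊢ rights T
open ⊢ˢ_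

↭-lefts : ∀ {T T'} → T ↭ T' → lefts T ↭ lefts T'
↭-lefts refl                       = refl
↭-lefts (prep (lf , A) p)          = prep A (↭-lefts p)
↭-lefts (prep (rt , A) p)          = ↭-lefts p
↭-lefts (swap (lf , A) (lf , B) p) = swap A B (↭-lefts p)
↭-lefts (swap (lf , A) (rt , B) p) = prep A (↭-lefts p)
↭-lefts (swap (rt , A) (lf , B) p) = prep B (↭-lefts p)
↭-lefts (swap (rt , A) (rt , B) p) = ↭-lefts p
↭-lefts (trans p q)                = trans (↭-lefts p) (↭-lefts q)

↭-rights : ∀ {T T'} → T ↭ T' → rights T ↭ rights T'
↭-rights refl                       = refl
↭-rights (prep (lf , A) p)          = ↭-rights p
↭-rights (prep (rt , A) p)          = prep A (↭-rights p)
↭-rights (swap (lf , A) (lf , B) p) = ↭-rights p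
↭-rights (swap (lf , A) (rt , B) p) = prep B (↭-rights p)
↭-rights (swap (rt , A) (lf , B) p) = prep A (↭-rights p)
↭-rights (swap (rt , A) (rt , B) p) = swap A B (↭-rights p)
↭-rights (trans p q)                = trans (↭-rights p) (↭-rights q)

lefts-++ : ∀ U V → lefts (U ++ V) ≡ lefts U ++ lefts V
lefts-++ []             V = refl
lefts-++ ((lf , A) ∷ U) V = cong (A ∷_) (lefts-++ U V)
lefts-++ ((rt , A) ∷ U) V = lefts-++ U V

rights-++ : ∀ U V → rights (U ++ V) ≡ rights U ++ rights V
rights-++ []             V = refl
rights-++ ((lf , A) ∷ U) V = rights-++ U V
rights-++ ((rt , A) ∷ U) V = cong (A ∷_) (rights-++ U V)

lefts-sequent : ∀ Γ Δ → lefts (map (lf ,_) Γ ++ map (rt ,_) Δ) ≡ Γ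
lefts-sequent (A ∷ Γ) Δ      = cong (A ∷_) (lefts-sequent Γ Δ)
lefts-sequent []      []      = refl
lefts-sequent []      (A ∷ Δ) = lefts-sequent [] Δ

rights-sequent : ∀ Γ Δ → rights (map (lf ,_) Γ ++ map (rt ,_) Δ) ≡ Δ
rights-sequent (A ∷ Γ) Δ      = rights-sequent Γ Δ
rights-sequent []      []      = refl
rights-sequent []      (A ∷ Δ) = cong (A ∷_) (rights-sequent [] Δ)

unsign : ∀ Γ Δ → ⊢ˢ (map (lf ,_) Γ ++ map (rt ,_) Δ) → Γ ⊢ Δ
unsign Γ Δ (mk d) = subst₂ _⊢_ (lefts-sequent Γ Δ) (rights-sequent Γ Δ) d

exchangeˢ : ∀ {T T'} → T ↭ T' → ⊢ˢ T → ⊢ˢ T'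
exchangeˢ p (mk d) = mk (exch (↭-lefts p) (↭-rights p) d)

swapˢ : ∀ {x y T} → ⊢ˢ (x ∷ y ∷ T) → ⊢ˢ (y ∷ x ∷ T)
swapˢ {x} {y} = exchangeˢ (swap x y refl)

focus : ∀ U {x V} → ⊢ˢ (U ++ x ∷ V) → ⊢ˢ (x ∷ U ++ V)
focus U {x} {V} = exchangeˢ (shift x U V)

unfocus : ∀ U {x V} → ⊢ˢ (x ∷ U ++ V) → ⊢ˢ (U ++ x ∷ V)
unfocus U {x} {V} = exchangeˢ (↭-sym (shift x U V))

weakenˢ : ∀ x {T} → ⊢ˢ T → ⊢ˢ (x ∷ T)
weakenˢ (lf , A) (mk d) = mk (wL d)
weakenˢ (rt , A) (mk d) = mk (wR d)

weakenAllˢ : ∀ W {T} → ⊢ˢ T → ⊢ˢ (W ++ T)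
weakenAllˢ []      d = d
weakenAllˢ (x ∷ W) d = weakenˢ x (weakenAllˢ W d)

contractˢ : ∀ x {T} → ⊢ˢ (x ∷ x ∷ T) → ⊢ˢ (x ∷ T)
contractˢ (lf , A) (mk d) = mk (cL d)
contractˢ (rt , A) (mk d) = mk (cR d)

axiomˢ : ∀ U {x y V} → ⊢ˢ (x ∷ y ∷ []) → ⊢ˢ (x ∷ U ++ y ∷ V)
axiomˢ U {x} {y} {V} d =
  exchangeˢ (trans (++-comm (U ++ V) (x ∷ y ∷ [])) (prep x (↭-sym (shift y U V))))
            (weakenAllˢ (U ++ V) d)

¬Lˢ : ∀ {A T} → ⊢ˢ ((rt , A) ∷ T) → ⊢ˢ ((lf , ¬' A) ∷ T)
¬Lˢ (mk d) = mk (¬L d)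

¬Rˢ : ∀ {A T} → ⊢ˢ ((lf , A) ∷ T) → ⊢ˢ ((rt , ¬' A) ∷ T)
¬Rˢ (mk d) = mk (¬R d)

∧Rˢ : ∀ {A B T} → ⊢ˢ ((rt , A) ∷ T) → ⊢ˢ ((rt , B) ∷ T) → ⊢ˢ ((rt , A ∧' B) ∷ T)
∧Rˢ (mk d) (mk e) = mk (∧R d e)

∨R₁ˢ : ∀ {A B T} → ⊢ˢ ((rt , A) ∷ T) → ⊢ˢ ((rt , A ∨' B) ∷ T)
∨R₁ˢ (mk d) = mk (∨R₁ d)

∨R₂ˢ : ∀ {A B T} → ⊢ˢ ((rt , B) ∷ T) → ⊢ˢ ((rt , A ∨' B) ∷ T)
∨R₂ˢ (mk d) = mk (∨R₂ d)

-- ⇒L splits the context between its premises; the two halves of each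
-- side are interleaved back together by a permutation.
⇒Lˢ : ∀ U₁ V₁ {U₂ V₂ A B} →
      ⊢ˢ ((rt , A) ∷ U₁ ++ V₁) → ⊢ˢ ((lf , B) ∷ U₂ ++ V₂) →
      ⊢ˢ ((lf , A ⇒' B) ∷ (U₁ ++ U₂) ++ (V₁ ++ V₂))
⇒Lˢ U₁ V₁ {U₂} {V₂} {A} {B} (mk d) (mk e) =
  exchangeˢ (prep _ interleave)
    (mk (subst₂ (λ Γ Δ → (A ⇒' B) ∷ Γ ⊢ Δ)
                (sym (lefts-++ (U₁ ++ V₁) (U₂ ++ V₂)))
                (sym (rights-++ (U₁ ++ V₁) (U₂ ++ V₂)))
                (⇒L d e)))
  where
  interleave : (U₁ ++ V₁) ++ (U₂ ++ V₂) ↭ (U₁ ++ U₂) ++ (V₁ ++ V₂)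
  interleave = trans (↭-++-assoc U₁ V₁ (U₂ ++ V₂))
                 (trans (++⁺ˡ U₁ (shifts V₁ U₂))
                        (↭-sym (↭-++-assoc U₁ U₂ (V₁ ++ V₂))))

↑ˢ : Signed → Signed
↑ˢ (s , A) = (s , ↑ A)

lefts-↑ : ∀ T → lefts (map ↑ˢ T) ≡ map ↑ (lefts T)
lefts-↑ []             = refl
lefts-↑ ((lf , A) ∷ T) = cong (↑ A ∷_) (lefts-↑ T)
lefts-↑ ((rt , A) ∷ T) = lefts-↑ T

rights-↑ : ∀ T → rights (map ↑ˢ T) ≡ map ↑ (rights T)
rights-↑ []             = refl
rights-↑ ((lf , A) ∷ T) = rights-↑ T
rights-↑ ((rt , A) ∷ T) = cong (↑ A ∷_) (rights-↑ T)

∀Rˢ : ∀ U V {A} → ⊢ˢ ((rt , A) ∷ map ↑ˢ U ++ map ↑ˢ V) → ⊢ˢ ((rt , ∀' A) ∷ U ++ V)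
∀Rˢ U V {A} (mk d) =
  mk (∀R (subst₂ (λ Γ Δ → Γ ⊢ A ∷ Δ) (lefts-↑ (U ++ V)) (rights-↑ (U ++ V))
           (subst (λ T → lefts T ⊢ A ∷ rights T) (sym (map-++ ↑ˢ U V)) d)))

∃Lˢ : ∀ U V {A} → ⊢ˢ ((lf , A) ∷ map ↑ˢ U ++ map ↑ˢ V) → ⊢ˢ ((lf , ∃' A) ∷ U ++ V)
∃Lˢ U V {A} (mk d) =
  mk (∃L (subst₂ (λ Γ Δ → A ∷ Γ ⊢ Δ) (lefts-↑ (U ++ V)) (rights-↑ (U ++ V))
           (subst (λ T → A ∷ lefts T ⊢ rights T) (sym (map-++ ↑ˢ U V)) d)))

mutual
  subT-renT : ∀ σ ρ → (∀ x → σ (ρ x) ≡ var x) → ∀ t → subT σ (renT ρ t) ≡ t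
  subT-renT σ ρ inv (var x)    = inv x
  subT-renT σ ρ inv (fun f ts) = cong (fun f) (subTs-renTs σ ρ inv ts)

  subTs-renTs : ∀ σ ρ → (∀ x → σ (ρ x) ≡ var x) → ∀ ts → subTs σ (renTs ρ ts) ≡ ts
  subTs-renTs σ ρ inv []       = refl
  subTs-renTs σ ρ inv (t ∷ ts) = cong₂ _∷_ (subT-renT σ ρ inv t) (subTs-renTs σ ρ inv ts)

ext-inverse : ∀ σ ρ → (∀ x → σ (ρ x) ≡ var x) → ∀ x → extS σ (extR ρ x) ≡ var x
ext-inverse σ ρ inv zero    = refl
ext-inverse σ ρ inv (suc x) = cong (renT suc) (inv x)

subF-renF : ∀ σ ρ → (∀ x → σ (ρ x) ≡ var x) → ∀ A → subF σ (renF ρ A) ≡ A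
subF-renF σ ρ inv (atom P ts) = cong (atom P) (subTs-renTs σ ρ inv ts)
subF-renF σ ρ inv (A ∧' B)    = cong₂ _∧'_ (subF-renF σ ρ inv A) (subF-renF σ ρ inv B)
subF-renF σ ρ inv (A ∨' B)    = cong₂ _∨'_ (subF-renF σ ρ inv A) (subF-renF σ ρ inv B)
subF-renF σ ρ inv (A ⇒' B)    = cong₂ _⇒'_ (subF-renF σ ρ inv A) (subF-renF σ ρ inv B)
subF-renF σ ρ inv (¬' A)      = cong ¬'_ (subF-renF σ ρ inv A)
subF-renF σ ρ inv (∀' A)      = cong ∀'_ (subF-renF (extS σ) (extR ρ) (ext-inverse σ ρ inv) A)
subF-renF σ ρ inv (∃' A)      = cong ∃'_ (subF-renF (extS σ) (extR ρ) (ext-inverse σ ρ inv) A)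

-- Under ↑ a quantifier body becomes  renF (extR suc) A;  instantiating it
-- with the eigenvariable  var 0  gives back A.  Needed to match ∀L / ∃R
-- against ∀R in the quantifier cases of the axiom lemma.
instantiate-fresh : ∀ A → renF (extR suc) A [ var zero ] ≡ A
instantiate-fresh = subF-renF (single (var zero)) (extR suc) inverse
  where
  inverse : ∀ x → single (var zero) (extR suc x) ≡ var x
  inverse zero    = refl
  inverse (suc x) = refl

-- The ¬-flip constructors erase a negation by moving to the other side;
-- the "dual" constructors read a conjunction / universal on the left whose
-- components live on the right as a disjunction / existential on the right.
data Decode : Side → Formula → Signed → Set where
  atomˡ    : ∀ {P ts} → Decode lf (atom P ts) (lf , atom P ts)
  atomʳ    : ∀ {P ts} → Decode rt (atom P ts) (rt , atom P ts)
  ¬flipˡ   : ∀ {F x} → Decode rt F x → Decode lf (¬' F) x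
  ¬flipʳ   : ∀ {F x} → Decode lf F x → Decode rt (¬' F) x
  ¬ˡ       : ∀ {F A} → Decode rt F (rt , A) → Decode lf (¬' F) (lf , ¬' A)
  ¬ʳ       : ∀ {F A} → Decode lf F (lf , A) → Decode rt (¬' F) (rt , ¬' A)
  ∧ˡ       : ∀ {F G A B} → Decode lf F (lf , A) → Decode lf G (lf , B) →
             Decode lf (F ∧' G) (lf , A ∧' B)
  ∧ˡ-dual  : ∀ {F G A B} → Decode lf F (rt , A) → Decode lf G (rt , B) →
             Decode lf (F ∧' G) (rt , A ∨' B)
  ∧ʳ       : ∀ {F G A B} → Decode rt F (rt , A) → Decode rt G (rt , B) →
             Decode rt (F ∧' G) (rt , A ∧' B)
  ∨ˡ       : ∀ {F G A B} → Decode lf F (lf , A) → Decode lf G (lf , B) →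
             Decode lf (F ∨' G) (lf , A ∨' B)
  ⇒ˡ       : ∀ {F G A B} → Decode rt F (rt , A) → Decode lf G (lf , B) →
             Decode lf (F ⇒' G) (lf , A ⇒' B)
  ⇒ʳ       : ∀ {F G A B} → Decode lf F (lf , A) → Decode rt G (rt , B) →
             Decode rt (F ⇒' G) (rt , A ⇒' B)
  ∀ˡ       : ∀ {F A} → Decode lf F (lf , A) → Decode lf (∀' F) (lf , ∀' A)
  ∀ˡ-dual  : ∀ {F A} → Decode lf F (rt , A) → Decode lf (∀' F) (rt , ∃' A)
  ∀ʳ       : ∀ {F A} → Decode rt F (rt , A) → Decode rt (∀' F) (rt , ∀' A)
  ∃ˡ       : ∀ {F A} → Decode lf F (lf , A) → Decode lf (∃' F) (lf , ∃' A)

renDecode : ∀ ρ {s F t A} → Decode s F (t , A) → Decode s (renF ρ F) (t , renF ρ A)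
renDecode ρ atomˡ         = atomˡ
renDecode ρ atomʳ         = atomʳ
renDecode ρ (¬flipˡ d)    = ¬flipˡ (renDecode ρ d)
renDecode ρ (¬flipʳ d)    = ¬flipʳ (renDecode ρ d)
renDecode ρ (¬ˡ d)        = ¬ˡ (renDecode ρ d)
renDecode ρ (¬ʳ d)        = ¬ʳ (renDecode ρ d)
renDecode ρ (∧ˡ d e)      = ∧ˡ (renDecode ρ d) (renDecode ρ e)
renDecode ρ (∧ˡ-dual d e) = ∧ˡ-dual (renDecode ρ d) (renDecode ρ e)
renDecode ρ (∧ʳ d e)      = ∧ʳ (renDecode ρ d) (renDecode ρ e)
renDecode ρ (∨ˡ d e)      = ∨ˡ (renDecode ρ d) (renDecode ρ e)
renDecode ρ (⇒ˡ d e)      = ⇒ˡ (renDecode ρ d) (renDecode ρ e)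
renDecode ρ (⇒ʳ d e)      = ⇒ʳ (renDecode ρ d) (renDecode ρ e)
renDecode ρ (∀ˡ d)        = ∀ˡ (renDecode (extR ρ) d)
renDecode ρ (∀ˡ-dual d)   = ∀ˡ-dual (renDecode (extR ρ) d)
renDecode ρ (∀ʳ d)        = ∀ʳ (renDecode (extR ρ) d)
renDecode ρ (∃ˡ d)        = ∃ˡ (renDecode (extR ρ) d)

subDecode : ∀ σ {s F t A} → Decode s F (t , A) → Decode s (subF σ F) (t , subF σ A)
subDecode σ atomˡ         = atomˡ
subDecode σ atomʳ         = atomʳ
subDecode σ (¬flipˡ d)    = ¬flipˡ (subDecode σ d)
subDecode σ (¬flipʳ d)    = ¬flipʳ (subDecode σ d)
subDecode σ (¬ˡ d)        = ¬ˡ (subDecode σ d)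
subDecode σ (¬ʳ d)        = ¬ʳ (subDecode σ d)
subDecode σ (∧ˡ d e)      = ∧ˡ (subDecode σ d) (subDecode σ e)
subDecode σ (∧ˡ-dual d e) = ∧ˡ-dual (subDecode σ d) (subDecode σ e)
subDecode σ (∧ʳ d e)      = ∧ʳ (subDecode σ d) (subDecode σ e)
subDecode σ (∨ˡ d e)      = ∨ˡ (subDecode σ d) (subDecode σ e)
subDecode σ (⇒ˡ d e)      = ⇒ˡ (subDecode σ d) (subDecode σ e)
subDecode σ (⇒ʳ d e)      = ⇒ʳ (subDecode σ d) (subDecode σ e)
subDecode σ (∀ˡ d)        = ∀ˡ (subDecode (extS σ) d)
subDecode σ (∀ˡ-dual d)   = ∀ˡ-dual (subDecode (extS σ) d)
subDecode σ (∀ʳ d)        = ∀ʳ (subDecode (extS σ) d)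
subDecode σ (∃ˡ d)        = ∃ˡ (subDecode (extS σ) d)

-- The two readings of one formula F, taken on the left and on the right,
-- always form a derivable signed sequent: the image of the axiom  F ⊢ F.
decode-axiom : ∀ {F x y} → Decode lf F x → Decode rt F y → ⊢ˢ (x ∷ y ∷ [])
decode-axiom atomˡ         atomʳ        = mk ax
decode-axiom (¬flipˡ e)    (¬flipʳ f)   = swapˢ (decode-axiom f e)
decode-axiom (¬ˡ e)        (¬flipʳ f)   = ¬Lˢ (swapˢ (decode-axiom f e))
decode-axiom (¬flipˡ e)    (¬ʳ f)       = swapˢ (¬Rˢ (decode-axiom f e))
decode-axiom (¬ˡ e)        (¬ʳ f)       = ¬Lˢ (swapˢ (¬Rˢ (decode-axiom f e)))
decode-axiom (∧ˡ e₁ e₂)    (∧ʳ f₁ f₂)   =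
  mk (∧R (∧L₁ (proof (decode-axiom e₁ f₁))) (∧L₂ (proof (decode-axiom e₂ f₂))))
decode-axiom (∧ˡ-dual e₁ e₂) (∧ʳ f₁ f₂) =
  swapˢ (∧Rˢ (swapˢ (∨R₁ˢ (decode-axiom e₁ f₁))) (swapˢ (∨R₂ˢ (decode-axiom e₂ f₂))))
decode-axiom (⇒ˡ e₁ e₂)    (⇒ʳ f₁ f₂)   =
  mk (⇒R (exch (swap _ _ refl) refl
    (⇒L {Γ₁ = _ ∷ []} {Γ₂ = []} {Δ₁ = []}
        (proof (decode-axiom f₁ e₁)) (proof (decode-axiom e₂ f₂)))))
decode-axiom (∀ˡ {A = A} e) (∀ʳ f)     =
  mk (∀R (∀L (var zero)
    (subst (λ G → G ∷ [] ⊢ _ ∷ []) (sym (instantiate-fresh A)) (proof (decode-axiom e f)))))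
decode-axiom (∀ˡ-dual {A = A} e) (∀ʳ f) =
  swapˢ (mk (∀R (exch refl (swap _ _ refl) (∃R (var zero)
    (subst (λ G → [] ⊢ G ∷ _ ∷ []) (sym (instantiate-fresh A)) (proof (decode-axiom e f)))))))

Decodes : Side → Ctx → List Signed → Set
Decodes s = Pointwise (Decode s)

data Split (s : Side) (Γ₁ Γ₂ : Ctx) : List Signed → Set where
  split : ∀ {U₁ U₂} → Decodes s Γ₁ U₁ → Decodes s Γ₂ U₂ → Split s Γ₁ Γ₂ (U₁ ++ U₂)

split-++ : ∀ {s} Γ₁ {Γ₂ U} → Decodes s (Γ₁ ++ Γ₂) U → Split s Γ₁ Γ₂ U
split-++ []       p       = split [] p
split-++ (F ∷ Γ₁) (e ∷ p) with split-++ Γ₁ p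
... | split p₁ p₂ = split (e ∷ p₁) p₂

decodes-↭ : ∀ {s Γ Γ' U'} → Γ ↭ Γ' → Decodes s Γ' U' → ∃ λ U → Decodes s Γ U × U ↭ U'
decodes-↭ refl          p           = _ , p , refl
decodes-↭ (prep F π)    (e ∷ p)     =
  let (U , q , ρ) = decodes-↭ π p in _ , e ∷ q , prep _ ρ
decodes-↭ (swap F G π)  (e ∷ f ∷ p) =
  let (U , q , ρ) = decodes-↭ π p in _ , f ∷ e ∷ q , swap _ _ ρ
decodes-↭ (trans π π')  p           =
  let (U₁ , q₁ , ρ₁) = decodes-↭ π' p
      (U₀ , q₀ , ρ₀) = decodes-↭ π q₁
  in U₀ , q₀ , trans ρ₀ ρ₁

decodes-↑ : ∀ {s Γ U} → Decodes s Γ U → Decodes s (map ↑ Γ) (map ↑ˢ U)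
decodes-↑ []      = []
decodes-↑ (e ∷ p) = renDecode suc e ∷ decodes-↑ p

decodes-map : ∀ {s} {f : Formula → Formula} {g : Formula → Signed} →
              (∀ A → Decode s (f A) (g A)) → ∀ Γ → Decodes s (map f Γ) (map g Γ)
decodes-map dec []      = []
decodes-map dec (A ∷ Γ) = dec A ∷ decodes-map dec Γ

infix 4 _∣_

data Decoding (Γ Δ : Ctx) : List Signed → Set where
  _∣_ : ∀ {U V} → Decodes lf Γ U → Decodes rt Δ V → Decoding Γ Δ (U ++ V)

-- The right rules for ∨ and ∃ cannot occur with a decoded principal
-- formula, since no disjunction or existential is decodable on the right.
simulate : ∀ {Γ Δ T} → Γ ⊢ Δ → Decoding Γ Δ T → ⊢ˢ T
simulate ax (_∣_ {U = _ ∷ U} (e ∷ _) (f ∷ _)) = axiomˢ U (decode-axiom e f)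
simulate (exch π π' d) (p ∣ q) =
  let (U , p₀ , ρ)  = decodes-↭ π p
      (V , q₀ , ρ') = decodes-↭ π' q
  in exchangeˢ (++⁺ ρ ρ') (simulate d (p₀ ∣ q₀))
simulate (wL d) ((_ ∷ p) ∣ q) = weakenˢ _ (simulate d (p ∣ q))
simulate (wR d) (_∣_ {U = U} p (_ ∷ q)) = unfocus U (weakenˢ _ (simulate d (p ∣ q)))
simulate (cL d) ((e ∷ p) ∣ q) = contractˢ _ (simulate d ((e ∷ e ∷ p) ∣ q))
simulate (cR d) (_∣_ {U = U} p (e ∷ q)) =
  unfocus U (contractˢ _ (focus (_ ∷ U) (focus U (simulate d (p ∣ (e ∷ e ∷ q))))))
simulate (∧L₁ d) ((∧ˡ e _ ∷ p) ∣ q)      = mk (∧L₁ (proof (simulate d ((e ∷ p) ∣ q))))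
simulate (∧L₁ d) ((∧ˡ-dual e _ ∷ p) ∣ q) = ∨R₁ˢ (simulate d ((e ∷ p) ∣ q))
simulate (∧L₂ d) ((∧ˡ _ e ∷ p) ∣ q)      = mk (∧L₂ (proof (simulate d ((e ∷ p) ∣ q))))
simulate (∧L₂ d) ((∧ˡ-dual _ e ∷ p) ∣ q) = ∨R₂ˢ (simulate d ((e ∷ p) ∣ q))
simulate (∧R d d') (_∣_ {U = U} p (∧ʳ e e' ∷ q)) =
  unfocus U (∧Rˢ (focus U (simulate d (p ∣ (e ∷ q)))) (focus U (simulate d' (p ∣ (e' ∷ q)))))
simulate (∨L d d') ((∨ˡ e e' ∷ p) ∣ q) =
  mk (∨L (proof (simulate d ((e ∷ p) ∣ q))) (proof (simulate d' ((e' ∷ p) ∣ q))))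
simulate (∨R₁ d) (p ∣ (() ∷ q))
simulate (∨R₂ d) (p ∣ (() ∷ q))
simulate (⇒L {Γ₁ = Γ₁} {Δ₁ = Δ₁} d d') ((⇒ˡ e e' ∷ p) ∣ q)
  with split-++ Γ₁ p | split-++ Δ₁ q
... | split {U₁} p₁ p₂ | split {V₁} q₁ q₂ =
  ⇒Lˢ U₁ V₁ (focus U₁ (simulate d (p₁ ∣ (e ∷ q₁)))) (simulate d' ((e' ∷ p₂) ∣ q₂))
simulate (⇒R d) (_∣_ {U = U} p (⇒ʳ e e' ∷ q)) =
  unfocus U (mk (⇒R (proof (focus (_ ∷ U) (simulate d ((e ∷ p) ∣ (e' ∷ q)))))))
simulate (¬L d) (_∣_ {U = _ ∷ U} (¬flipˡ e ∷ p) q) = focus U (simulate d (p ∣ (e ∷ q)))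
simulate (¬L d) (_∣_ {U = _ ∷ U} (¬ˡ e ∷ p) q)     = ¬Lˢ (focus U (simulate d (p ∣ (e ∷ q))))
simulate (¬R d) (_∣_ {U = U} p (¬flipʳ e ∷ q))     = unfocus U (simulate d ((e ∷ p) ∣ q))
simulate (¬R d) (_∣_ {U = U} p (¬ʳ e ∷ q))         = unfocus U (¬Rˢ (simulate d ((e ∷ p) ∣ q)))
simulate (∀L t d) ((∀ˡ e ∷ p) ∣ q) =
  mk (∀L t (proof (simulate d ((subDecode (single t) e ∷ p) ∣ q))))
simulate (∀L t d) ((∀ˡ-dual e ∷ p) ∣ q) =
  mk (∃R t (proof (simulate d ((subDecode (single t) e ∷ p) ∣ q))))
simulate (∀R d) (_∣_ {U = U} {_ ∷ V} p (∀ʳ e ∷ q)) =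
  unfocus U (∀Rˢ U V (focus (map ↑ˢ U) (simulate d (decodes-↑ p ∣ (e ∷ decodes-↑ q)))))
simulate (∃L d) (_∣_ {U = _ ∷ U} {V} (∃ˡ e ∷ p) q) =
  ∃Lˢ U V (simulate d ((e ∷ decodes-↑ p) ∣ decodes-↑ q))
simulate (∃R t d) (p ∣ (() ∷ q))

mutual
  decode-ᵖ : ∀ A → Decode lf (A ᵖ) (lf , A)
  decode-ᵖ (atom P ts) = atomˡ
  decode-ᵖ (A ∧' B)    = ∧ˡ (decode-ᵖ A) (decode-ᵖ B)
  decode-ᵖ (A ∨' B)    = ∨ˡ (decode-ᵖ A) (decode-ᵖ B)
  decode-ᵖ (A ⇒' B)    = ⇒ˡ (decode-ⁿ A) (decode-ᵖ B)
  decode-ᵖ (¬' A)      = ¬ˡ (decode-ⁿ A)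
  decode-ᵖ (∀' A)      = ∀ˡ (decode-ᵖ A)
  decode-ᵖ (∃' A)      = ∃ˡ (decode-ᵖ A)

  decode-ⁿ : ∀ A → Decode rt (A ⁿ) (rt , A)
  decode-ⁿ (atom P ts) = ¬flipʳ (¬flipˡ atomʳ)
  decode-ⁿ (A ∧' B)    = ∧ʳ (decode-ⁿ A) (decode-ⁿ B)
  decode-ⁿ (A ∨' B)    = ¬flipʳ (∧ˡ-dual (¬flipˡ (decode-ⁿ A)) (¬flipˡ (decode-ⁿ B)))
  decode-ⁿ (A ⇒' B)    = ⇒ʳ (decode-ᵖ A) (decode-ⁿ B)
  decode-ⁿ (¬' A)      = ¬ʳ (decode-ᵖ A)
  decode-ⁿ (∀' A)      = ∀ʳ (decode-ⁿ A)
  decode-ⁿ (∃' A)      = ¬flipʳ (∀ˡ-dual (¬flipˡ (decode-ⁿ A)))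

-- Where ⌟(Aⁿ) on the left lands: A on the right, except that for A = ¬B
-- the antinegation strips the negation and B stays on the left.
corner : Formula → Signed
corner (¬' B) = (lf , B)
corner A      = (rt , A)

decode-⌟ⁿ : ∀ A → Decode lf (⌟ (A ⁿ)) (corner A)
decode-⌟ⁿ (atom P ts) = ¬flipˡ atomʳ
decode-⌟ⁿ (A ∧' B)    = ¬flipˡ (decode-ⁿ (A ∧' B))
decode-⌟ⁿ (A ∨' B)    = ∧ˡ-dual (¬flipˡ (decode-ⁿ A)) (¬flipˡ (decode-ⁿ B))
decode-⌟ⁿ (A ⇒' B)    = ¬flipˡ (decode-ⁿ (A ⇒' B))
decode-⌟ⁿ (¬' A)      = decode-ᵖ A
decode-⌟ⁿ (∀' A)      = ¬flipˡ (decode-ⁿ (∀' A))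
decode-⌟ⁿ (∃' A)      = ∀ˡ-dual (¬flipˡ (decode-ⁿ A))

restore-corner : ∀ A {T} → ⊢ˢ (corner A ∷ T) → ⊢ˢ ((rt , A) ∷ T)
restore-corner (atom P ts) d = d
restore-corner (A ∧' B)    d = d
restore-corner (A ∨' B)    d = d
restore-corner (A ⇒' B)    d = d
restore-corner (¬' A)      d = ¬Rˢ d
restore-corner (∀' A)      d = d
restore-corner (∃' A)      d = d

restore-corners : ∀ Δ U {W} → ⊢ˢ (U ++ map corner Δ ++ W) → ⊢ˢ (U ++ map (rt ,_) Δ ++ W)
restore-corners []      U d = d
restore-corners (A ∷ Δ) U d =
  unfocus U (restore-corner A (restore-corners Δ (corner A ∷ U) (focus U d)))

decode-goal : ∀ D → Decodes rt (opt (optMap _ⁿ D)) (map (rt ,_) (opt D))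
decode-goal nothing  = []
decode-goal (just A) = decode-ⁿ A ∷ []

corollary1 : (Γ Δ : List Formula) (D : Maybe Formula) →
    Σ (map _ᵖ Γ ++ map (λ A → ⌟ (A ⁿ)) Δ ⊢ opt (optMap _ⁿ D)) Intuitionistic →
    Γ ⊢ Δ ++ opt D
corollary1 Γ Δ D (d , _) = unsign Γ (Δ ++ opt D) (subst ⊢ˢ_ regroup-goal restored)
  where
  hypotheses : Decodes lf (map _ᵖ Γ ++ map (λ A → ⌟ (A ⁿ)) Δ) (map (lf ,_) Γ ++ map corner Δ)
  hypotheses = join-++ (decodes-map decode-ᵖ Γ) (decodes-map decode-⌟ⁿ Δ)

  decoded : ⊢ˢ (map (lf ,_) Γ ++ map corner Δ ++ map (rt ,_) (opt D))
  decoded = subst ⊢ˢ_ (++-assoc (map (lf ,_) Γ) (map corner Δ) _)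
                  (simulate d (hypotheses ∣ decode-goal D))

  restored : ⊢ˢ (map (lf ,_) Γ ++ map (rt ,_) Δ ++ map (rt ,_) (opt D))
  restored = restore-corners Δ (map (lf ,_) Γ) decoded

  regroup-goal : map (lf ,_) Γ ++ map (rt ,_) Δ ++ map (rt ,_) (opt D)
               ≡ map (lf ,_) Γ ++ map (rt ,_) (Δ ++ opt D)
  regroup-goal = cong (map (lf ,_) Γ ++_) (sym (map-++ (rt ,_) Δ (opt D)))
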